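{- Let $K$ be a finite poset and $f\in\mathrm{Or}(K)$ with $f=f_1\cdots f_k$ (composition) for some $f_1,\ldots,f_k\in\mathrm{Or}(K)$. Then the following are equivalent: (1) $f$ is idempotent; (2) $f_if=f$ for all $i\in\{1,\ldots,k\}$; (3) $ff_i=f$ for all $i\in\{1,\ldots,k\}$.
   Context: $\mathrm{Or}(K)$ is the monoid, under composition of functions, of maps $f:K\to K$ that are order preserving and regressive ($f(x)\leqslant x$ for all $x\in K$). Composition is written by juxtaposition. -}

module Defs where

open import Level using (Level; _⊔_)
open import Data.Nat using (ℕ)
open import Data.Fin using (Fin)
open import Data.List using (List; []; _∷_)
open import Data.List.Membership.Propositional using (_∈_)
open import Data.Product using (Σ; _×_)
open import Function using (_∘_; id)
open import Function.Bundles using (_↔_)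
open import Relation.Binary.Bundles using (Poset)

record FinitePoset (c ℓ₁ ℓ₂ : Level) : Set (Level.suc (c ⊔ ℓ₁ ⊔ ℓ₂)) where
  field
    poset  : Poset c ℓ₁ ℓ₂
    size   : ℕ
    enum   : Poset.Carrier poset ↔ Fin size
  open Poset poset public

module _ {c ℓ₁ ℓ₂ : Level} (K : FinitePoset c ℓ₁ ℓ₂) where
  open FinitePoset K

  record Or : Set (c ⊔ ℓ₁ ⊔ ℓ₂) where
    constructor mkOr
    field
      fun        : Carrier → Carrier
      monotone   : ∀ {x y} → x ≤ y → fun x ≤ fun y
      regressive : ∀ x → fun x ≤ x

  idOr : Or
  idOr = mkOr id id (λ _ → refl)

  _·_ : Or → Or → Or
  f · g = mkOr (Or.fun f ∘ Or.fun g)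
               (Or.monotone f ∘ Or.monotone g)
               (λ x → trans (Or.regressive f (Or.fun g x)) (Or.regressive g x))

  _≐_ : Or → Or → Set (c ⊔ ℓ₁)
  f ≐ g = ∀ x → Or.fun f x ≈ Or.fun g x

  prod : List Or → Or
  prod []       = idOr
  prod (f ∷ fs) = f · prod fs

  Idempotent : Or → Set (c ⊔ ℓ₁)
  Idempotent f = (f · f) ≐ f

-- A product of regressive monotone maps lies
-- below each of its factors, so if f = f₁ ⋯ fₖ is idempotent then
-- f x = f (f x) ≤ fᵢ (f x) ≤ f x.  Conversely, if every factor fixes the image
-- of f (or is absorbed by f on the right), so does their product, which is f.
-- Finally, fᵢ f = f forces f fᵢ = f for idempotent f, because
-- f x = f (fᵢ (f x)) ≤ f (fᵢ x) ≤ f x.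
module Submission where

open import Defs
open import Level using (Level)
open import Data.List using (List; []; _∷_)
open import Data.List.Membership.Propositional using (_∈_)
open import Data.List.Relation.Unary.Any using (here; there)
open import Data.Product using (_×_; _,_)
open import Function.Bundles using (_⇔_; mk⇔)
open import Relation.Binary.PropositionalEquality using () renaming (refl to ≡-refl)
import Relation.Binary.Reasoning.PartialOrder as PartialOrderReasoning

module _ {c ℓ₁ ℓ₂ : Level} (K : FinitePoset c ℓ₁ ℓ₂) where
  open FinitePoset K
  open Or
  open PartialOrderReasoning poset

  fun-cong : (g : Or K) → ∀ {x y} → x ≈ y → fun g x ≈ fun g y
  fun-cong g x≈y = antisym (monotone g (reflexive x≈y)) (monotone g (reflexive (Eq.sym x≈y)))

  prod-≤-member : ∀ {g} fs → g ∈ fs → ∀ x → fun (prod K fs) x ≤ fun g x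
  prod-≤-member (h ∷ hs) (here ≡-refl) x = monotone h (regressive (prod K hs) x)
  prod-≤-member (h ∷ hs) (there g∈hs) x =
    trans (regressive h _) (prod-≤-member hs g∈hs x)

  prod-fixes : ∀ fs {y} → (∀ g → g ∈ fs → fun g y ≈ y) → fun (prod K fs) y ≈ y
  prod-fixes []       fixes = Eq.refl
  prod-fixes (h ∷ hs) fixes =
    Eq.trans (fun-cong h (prod-fixes hs (λ g g∈hs → fixes g (there g∈hs))))
             (fixes h (here ≡-refl))

  prod-absorbedʳ : ∀ (f : Or K) fs → (∀ g → g ∈ fs → _≐_ K (_·_ K f g) f) →
                   _≐_ K (_·_ K f (prod K fs)) f
  prod-absorbedʳ f []       absorbed x = Eq.refl
  prod-absorbedʳ f (h ∷ hs) absorbed x =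
    Eq.trans (absorbed h (here ≡-refl) _)
             (prod-absorbedʳ f hs (λ g g∈hs → absorbed g (there g∈hs)) x)

  module _ (f : Or K) (fs : List (Or K)) (f≐prod : _≐_ K f (prod K fs)) where

    idempotent⇒member-fixes : Idempotent K f → ∀ g → g ∈ fs → _≐_ K (_·_ K g f) f
    idempotent⇒member-fixes idem g g∈fs x = antisym (regressive g _) (begin
      fun f x                    ≈⟨ Eq.sym (idem x) ⟩
      fun f (fun f x)            ≈⟨ f≐prod _ ⟩
      fun (prod K fs) (fun f x)  ≤⟨ prod-≤-member fs g∈fs _ ⟩
      fun g (fun f x)            ∎)

    members-fix⇒idempotent : (∀ g → g ∈ fs → _≐_ K (_·_ K g f) f) → Idempotent K f
    members-fix⇒idempotent fixes x =
      Eq.trans (f≐prod _) (prod-fixes fs (λ g g∈fs → fixes g g∈fs x))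

    members-absorbed⇒idempotent : (∀ g → g ∈ fs → _≐_ K (_·_ K f g) f) → Idempotent K f
    members-absorbed⇒idempotent absorbed x =
      Eq.trans (fun-cong f (f≐prod x)) (prod-absorbedʳ f fs absorbed x)

  idempotent-fixed⇒absorbedʳ : ∀ (f g : Or K) → Idempotent K f →
                               _≐_ K (_·_ K g f) f → _≐_ K (_·_ K f g) f
  idempotent-fixed⇒absorbedʳ f g idem gf≐f x =
    antisym (monotone f (regressive g x)) (begin
      fun f x                    ≈⟨ Eq.sym (idem x) ⟩
      fun f (fun f x)            ≈⟨ fun-cong f (Eq.sym (gf≐f x)) ⟩
      fun f (fun g (fun f x))    ≤⟨ monotone f (monotone g (regressive f x)) ⟩
      fun f (fun g x)            ∎)

proposition3p3 : {c ℓ₁ ℓ₂ : Level} (K : FinitePoset c ℓ₁ ℓ₂) (f : Or K) (fs : List (Or K)) →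
    _≐_ K f (prod K fs) →
    (Idempotent K f ⇔ (∀ g → g ∈ fs → _≐_ K (_·_ K g f) f))
    × (Idempotent K f ⇔ (∀ g → g ∈ fs → _≐_ K (_·_ K f g) f))
proposition3p3 K f fs f≐prod =
  mk⇔ (idempotent⇒member-fixes K f fs f≐prod) (members-fix⇒idempotent K f fs f≐prod) ,
  mk⇔ (λ idem g g∈fs → idempotent-fixed⇒absorbedʳ K f g idem
                         (idempotent⇒member-fixes K f fs f≐prod idem g g∈fs))
      (members-absorbed⇒idempotent K f fs f≐prod)
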